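{- Let $\mathcal{C}$ be a quiver and $x$ a vertex of $\mathcal{C}$. Let $Q$ be the quiver obtained from $\mathcal{C}$ by adding two new vertices $y,z$ and the three arrows $x\to y$, $y\to z$, $z\to x$ (so $y$ and $z$ are adjacent only to each other and to $x$). If $\mathbf{i}_{\mathcal{C}}$ is a maximal green sequence of $\mathcal{C}$, then the sequence consisting of $z$, followed by the vertices of $\mathbf{i}_{\mathcal{C}}$ in order, followed by $y$, followed by $z$ (i.e. the mutation sequence $\mu_z\mu_y\mu_{\mathcal{C}}\mu_z$ applied right to left) is a maximal green sequence of $Q$.
   Context: A quiver is a finite directed graph with no loops or oriented 2-cycles. Mutation $\mu_k$: (1) for every path $i\to k\to j$ add an arrow $i\to j$; (2) reverse all arrows incident to $k$; (3) remove a maximal collection of oriented 2-cycles, and arrows between two frozen vertices. The framed quiver $\widehat Q$ has an additional frozen vertex $i'$ and arrow $i\to i'$ for each vertex $i$ of $Q$; only mutable vertices are mutated. A mutable vertex $i$ of a quiver obtained from $\widehat Q$ by mutations is green if there is no arrow $j'\to i$ from a frozen vertex and red if there is no arrow $i\to j'$ to a frozen vertex. A maximal green sequence of $Q$ is a sequence $(i_1,\dots,i_r)$ of mutable vertices such that each $i_j$ is green in $\mu_{i_{j-1}}\cdots\mu_{i_1}(\widehat Q)$ and all mutable vertices are red in $\mu_{i_r}\cdots\mu_{i_1}(\widehat Q)$. -}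

module Defs where

open import Data.Nat using (ℕ; zero; suc; _+_; _*_; _∸_)
open import Data.Bool using (Bool; true; false; if_then_else_; _∧_; _∨_)
open import Data.Sum using (_⊎_; inj₁; inj₂)
open import Data.Sum.Properties using (≡-dec)
open import Data.Product using (_×_; _,_)
open import Data.Unit using (⊤)
open import Data.List using (List; []; _∷_)
open import Data.Fin using (Fin)
open import Relation.Nullary using (does)
open import Relation.Binary.Definitions using (DecidableEquality)
open import Relation.Binary.PropositionalEquality using (_≡_; refl)

-- Arrow multiplicities: arr i j = number of arrows i → j.
Arrows : Set → Set
Arrows V = V → V → ℕ

record Quiver (V : Set) : Set where
  field
    arr      : Arrows V
    noLoop   : ∀ i → arr i i ≡ 0
    no2cycle : ∀ i j → arr i j ≡ 0 ⊎ arr j i ≡ 0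
open Quiver public

-- Quivers with frozen vertices obtained from a framing: vertex set V ⊎ V,
-- inj₁ i = mutable vertex i, inj₂ i = frozen vertex i'.
isFrozen : {V : Set} → V ⊎ V → Bool
isFrozen (inj₁ _) = false
isFrozen (inj₂ _) = true

frame : {V : Set} → DecidableEquality V → Arrows V → Arrows (V ⊎ V)
frame _≟_ a (inj₁ i) (inj₁ j) = a i j
frame _≟_ a (inj₁ i) (inj₂ j) = if does (i ≟ j) then 1 else 0
frame _≟_ a (inj₂ i) (inj₁ j) = 0
frame _≟_ a (inj₂ i) (inj₂ j) = 0

-- Mutation μ_k at a mutable vertex k.
-- step (1)+(2): c i j = number of arrows i → j after adding composite arrows
-- i → k → j and reversing arrows incident to k;
-- step (3): remove maximal collection of 2-cycles (net count), and
-- remove arrows between two frozen vertices.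
mutate : {V : Set} → DecidableEquality V → V → Arrows (V ⊎ V) → Arrows (V ⊎ V)
mutate {V} _≟_ k b i j =
  if isFrozen i ∧ isFrozen j then 0 else (c i j ∸ c j i)
  where
  _≟'_ : DecidableEquality (V ⊎ V)
  _≟'_ = ≡-dec _≟_ _≟_
  kk : V ⊎ V
  kk = inj₁ k
  c : Arrows (V ⊎ V)
  c u w = if does (u ≟' kk) ∨ does (w ≟' kk)
          then b w u
          else b u w + b u kk * b kk w

mutateSeq : {V : Set} → DecidableEquality V → List V → Arrows (V ⊎ V) → Arrows (V ⊎ V)
mutateSeq _≟_ []       b = b
mutateSeq _≟_ (k ∷ ks) b = mutateSeq _≟_ ks (mutate _≟_ k b)

Green : {V : Set} → Arrows (V ⊎ V) → V → Set
Green {V} b i = (j : V) → b (inj₂ j) (inj₁ i) ≡ 0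

Red : {V : Set} → Arrows (V ⊎ V) → V → Set
Red {V} b i = (j : V) → b (inj₁ i) (inj₂ j) ≡ 0

GreenSeq : {V : Set} → DecidableEquality V → Arrows (V ⊎ V) → List V → Set
GreenSeq _≟_ b []       = ⊤
GreenSeq _≟_ b (k ∷ ks) = Green b k × GreenSeq _≟_ (mutate _≟_ k b) ks

MaximalGreenSequence : {V : Set} → DecidableEquality V → Quiver V → List V → Set
MaximalGreenSequence {V} _≟_ Q s =
  GreenSeq _≟_ (frame _≟_ (arr Q)) s
  × ((i : V) → Red (mutateSeq _≟_ s (frame _≟_ (arr Q))) i)

data YZ : Set where
  y z : YZ

_≟YZ_ : DecidableEquality YZ
y ≟YZ y = Relation.Nullary.yes refl
y ≟YZ z = Relation.Nullary.no (λ ())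
z ≟YZ y = Relation.Nullary.no (λ ())
z ≟YZ z = Relation.Nullary.yes refl

module _ {n : ℕ} where
  open import Data.Fin using (_≟_)

  ≟Ext : DecidableEquality (Fin n ⊎ YZ)
  ≟Ext = ≡-dec _≟_ _≟YZ_

  extArr : Quiver (Fin n) → Fin n → Arrows (Fin n ⊎ YZ)
  extArr C x (inj₁ i) (inj₁ j) = arr C i j
  extArr C x (inj₁ i) (inj₂ y) = if does (i ≟ x) then 1 else 0
  extArr C x (inj₁ i) (inj₂ z) = 0
  extArr C x (inj₂ y) (inj₂ z) = 1
  extArr C x (inj₂ z) (inj₁ j) = if does (j ≟ x) then 1 else 0
  extArr C x (inj₂ _) _        = 0

  extQuiver : Quiver (Fin n) → Fin n → Quiver (Fin n ⊎ YZ)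
  extQuiver C x = record { arr = extArr C x ; noLoop = nl ; no2cycle = n2 }
    where
    nl : ∀ i → extArr C x i i ≡ 0
    nl (inj₁ i) = noLoop C i
    nl (inj₂ y) = refl
    nl (inj₂ z) = refl
    n2 : ∀ i j → extArr C x i j ≡ 0 ⊎ extArr C x j i ≡ 0
    n2 (inj₁ i) (inj₁ j) = no2cycle C i j
    n2 (inj₁ i) (inj₂ y) = inj₂ refl
    n2 (inj₁ i) (inj₂ z) = inj₁ refl
    n2 (inj₂ y) (inj₁ j) = inj₁ refl
    n2 (inj₂ z) (inj₁ j) = inj₂ refl
    n2 (inj₂ y) (inj₂ y) = inj₁ refl
    n2 (inj₂ y) (inj₂ z) = inj₂ refl
    n2 (inj₂ z) (inj₂ y) = inj₁ refl
    n2 (inj₂ z) (inj₂ z) = inj₁ refl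

module Submission where

-- Write b for an exchange matrix of the framed quiver of C and
-- Q for C extended by the 3-cycle x → y → z → x.  After the first mutation
-- μ_z the framed quiver of Q has a very rigid shape, `embed b`: on C it is
-- the framed quiver of C, while the (now mutable) vertex z behaves exactly
-- like a copy of the frozen vertex x′ of C (arrows i → z mirror i → x′, and
-- z → i mirrors x′ → i), and y, z, y′, z′ carry four fixed arrows.
--   1. Mutation respects pointwise equality of exchange matrices, so we may
--      reason up to pointwise equality `_≐_` throughout.
--   2. `mutateZ-framedQ`: μ_z applied to the framed Q is `embed` of the
--      framed C.
--   3. `mutate-embed`: mutating at a vertex k of C that is green commutes
--      with `embed`; hence running the maximal green sequence of C inside Q
--      keeps the shape `embed b`, with each step green.
--   4. `finish`: once all vertices of C are red in b, the vertices y and z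
--      are green in turn and μ_z μ_y (embed b) has every vertex red.

open import Defs
open import Data.Nat using (ℕ; suc; _+_; _*_; _∸_)
open import Data.Nat.Properties using (*-zeroʳ; +-identityʳ; n∸n≡0; 0∸n≡0)
open import Data.Bool using (true; false; if_then_else_; _∧_; _∨_)
open import Data.Fin using (Fin; _≟_)
open import Data.List using (List; []; _∷_; _++_; map)
open import Data.Sum using (_⊎_; inj₁; inj₂)
open import Data.Sum.Properties using (≡-dec)
open import Data.Product using (_×_; _,_; proj₁; proj₂)
open import Data.Unit using (tt)
open import Relation.Nullary using (does)
open import Relation.Binary.Definitions using (DecidableEquality)
open import Relation.Binary.PropositionalEquality using (_≡_; refl; trans; cong; cong₂)

-- Pointwise equality of arrow multiplicities; exchange matrices are
-- functions, so this is the equality we can reason with.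
_≐_ : {W : Set} → Arrows W → Arrows W → Set
B ≐ B' = ∀ u w → B u w ≡ B' u w

≐-trans : {W : Set} {A B C : Arrows W} → A ≐ B → B ≐ C → A ≐ C
≐-trans p q u w = trans (p u w) (q u w)

-- Steps (1)+(2) of the mutation μ_k (composite arrows, reversal at k);
-- this is literally the auxiliary matrix inside `mutate`.
preMutate : {V : Set} → DecidableEquality V → V → Arrows (V ⊎ V) → Arrows (V ⊎ V)
preMutate _≟v_ k b u w =
  if does (≡-dec _≟v_ _≟v_ u (inj₁ k)) ∨ does (≡-dec _≟v_ _≟v_ w (inj₁ k))
  then b w u
  else b u w + b u (inj₁ k) * b (inj₁ k) w

mutate-cong : {V : Set} (_≟v_ : DecidableEquality V) (k : V) {B B' : Arrows (V ⊎ V)}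
  → B ≐ B' → mutate _≟v_ k B ≐ mutate _≟v_ k B'
mutate-cong _≟v_ k {B} {B'} e u w = cancel (isFrozen u ∧ isFrozen w)
  where
  pre : ∀ u w → preMutate _≟v_ k B u w ≡ preMutate _≟v_ k B' u w
  pre u w with does (≡-dec _≟v_ _≟v_ u (inj₁ k)) ∨ does (≡-dec _≟v_ _≟v_ w (inj₁ k))
  ... | true  = e w u
  ... | false = cong₂ _+_ (e u w) (cong₂ _*_ (e u _) (e _ w))
  cancel : ∀ d → (if d then 0 else (preMutate _≟v_ k B u w ∸ preMutate _≟v_ k B w u))
               ≡ (if d then 0 else (preMutate _≟v_ k B' u w ∸ preMutate _≟v_ k B' w u))
  cancel true  = refl
  cancel false = cong₂ _∸_ (pre u w) (pre w u)

mutateSeq-cong : {V : Set} (_≟v_ : DecidableEquality V) (s : List V) {B B' : Arrows (V ⊎ V)}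
  → B ≐ B' → mutateSeq _≟v_ s B ≐ mutateSeq _≟v_ s B'
mutateSeq-cong _≟v_ []      e = e
mutateSeq-cong _≟v_ (k ∷ s) e = mutateSeq-cong _≟v_ s (mutate-cong _≟v_ k e)

∸-one-sided : ∀ p q → p ≡ 0 ⊎ q ≡ 0 → p ∸ q ≡ p
∸-one-sided p .0 (inj₂ refl) = refl
∸-one-sided .0 q (inj₁ refl) = 0∸n≡0 q

zero-branches-∸ : ∀ d m → (if d then 0 else 0) ∸ m ≡ 0
zero-branches-∸ true  m = 0∸n≡0 m
zero-branches-∸ false m = 0∸n≡0 m

vanishing-branch-∸ : ∀ d m → m ≡ 0 → (if d ∨ false then 0 else m) ∸ (if d then 0 else 0) ≡ 0
vanishing-branch-∸ true  m _ = refl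
vanishing-branch-∸ false m e = e

red-source-∸ : ∀ p q → p ≡ 0 → (p + 0) ∸ q ≡ 0
red-source-∸ .0 q refl = 0∸n≡0 q

red-target-∸ : ∀ p q → q ≡ 0 → (p + 0) ∸ (q + 0) ≡ p
red-target-∸ p .0 refl = +-identityʳ p

module Construction {n : ℕ} (C : Quiver (Fin n)) (x : Fin n) where

  Vert : Set
  Vert = Fin n ⊎ YZ

  MatC : Set
  MatC = Arrows (Fin n ⊎ Fin n)

  MatQ : Set
  MatQ = Arrows (Vert ⊎ Vert)

  -- The shape of the framed Q after μ_z: b on C, z a mutable copy of the
  -- frozen x′, plus the fixed arrows z → y, z′ → z, y → y′, y → z′.
  embed : MatC → MatQ
  embed b (inj₂ _) (inj₂ _) = 0
  embed b (inj₁ (inj₁ i)) (inj₁ (inj₁ j)) = b (inj₁ i) (inj₁ j)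
  embed b (inj₁ (inj₁ i)) (inj₂ (inj₁ j)) = b (inj₁ i) (inj₂ j)
  embed b (inj₂ (inj₁ j)) (inj₁ (inj₁ i)) = b (inj₂ j) (inj₁ i)
  embed b (inj₁ (inj₁ i)) (inj₁ (inj₂ z)) = b (inj₁ i) (inj₂ x)
  embed b (inj₁ (inj₂ z)) (inj₁ (inj₁ i)) = b (inj₂ x) (inj₁ i)
  embed b (inj₁ (inj₂ z)) (inj₁ (inj₂ y)) = 1
  embed b (inj₂ (inj₂ z)) (inj₁ (inj₂ z)) = 1
  embed b (inj₁ (inj₂ y)) (inj₂ (inj₂ y)) = 1
  embed b (inj₁ (inj₂ y)) (inj₂ (inj₂ z)) = 1
  embed b _ _ = 0

  framedQ : MatQ
  framedQ = frame ≟Ext (extArr C x)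

  framedC : MatC
  framedC = frame _≟_ (arr C)

  -- Step 2: μ_z turns the framed Q into `embed framedC`: the composite
  -- y → z → x cancels x → y, the composite y → z → z′ creates y → z′, and
  -- the arrows at z are reversed (so x → z copies the framing arrow x → x′).
  mutateZ-framedQ : mutate ≟Ext (inj₂ z) framedQ ≐ embed framedC
  mutateZ-framedQ (inj₁ (inj₁ i)) (inj₁ (inj₁ j)) =
    trans (cong₂ _∸_ (+-identityʳ (arr C i j)) (+-identityʳ (arr C j i)))
          (∸-one-sided (arr C i j) (arr C j i) (no2cycle C i j))
  mutateZ-framedQ (inj₁ (inj₁ i)) (inj₁ (inj₂ y)) = n∸n≡0 ((if does (i ≟ x) then 1 else 0) + 0)
  mutateZ-framedQ (inj₁ (inj₁ i)) (inj₁ (inj₂ z)) = refl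
  mutateZ-framedQ (inj₁ (inj₁ i)) (inj₂ (inj₁ j)) = +-identityʳ _
  mutateZ-framedQ (inj₁ (inj₁ i)) (inj₂ (inj₂ y)) = refl
  mutateZ-framedQ (inj₁ (inj₁ i)) (inj₂ (inj₂ z)) = refl
  mutateZ-framedQ (inj₁ (inj₂ y)) (inj₁ (inj₁ j)) = n∸n≡0 ((if does (j ≟ x) then 1 else 0) + 0)
  mutateZ-framedQ (inj₁ (inj₂ y)) (inj₁ (inj₂ y)) = refl
  mutateZ-framedQ (inj₁ (inj₂ y)) (inj₁ (inj₂ z)) = refl
  mutateZ-framedQ (inj₁ (inj₂ y)) (inj₂ (inj₁ j)) = refl
  mutateZ-framedQ (inj₁ (inj₂ y)) (inj₂ (inj₂ y)) = refl
  mutateZ-framedQ (inj₁ (inj₂ y)) (inj₂ (inj₂ z)) = refl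
  mutateZ-framedQ (inj₁ (inj₂ z)) (inj₁ (inj₁ j)) = 0∸n≡0 (if does (j ≟ x) then 1 else 0)
  mutateZ-framedQ (inj₁ (inj₂ z)) (inj₁ (inj₂ y)) = refl
  mutateZ-framedQ (inj₁ (inj₂ z)) (inj₁ (inj₂ z)) = refl
  mutateZ-framedQ (inj₁ (inj₂ z)) (inj₂ (inj₁ j)) = refl
  mutateZ-framedQ (inj₁ (inj₂ z)) (inj₂ (inj₂ y)) = refl
  mutateZ-framedQ (inj₁ (inj₂ z)) (inj₂ (inj₂ z)) = refl
  mutateZ-framedQ (inj₂ (inj₁ i)) (inj₁ (inj₁ j)) = 0∸n≡0 ((if does (j ≟ i) then 1 else 0) + 0)
  mutateZ-framedQ (inj₂ (inj₁ i)) (inj₁ (inj₂ y)) = refl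
  mutateZ-framedQ (inj₂ (inj₁ i)) (inj₁ (inj₂ z)) = refl
  mutateZ-framedQ (inj₂ (inj₂ y)) (inj₁ (inj₁ j)) = refl
  mutateZ-framedQ (inj₂ (inj₂ y)) (inj₁ (inj₂ y)) = refl
  mutateZ-framedQ (inj₂ (inj₂ y)) (inj₁ (inj₂ z)) = refl
  mutateZ-framedQ (inj₂ (inj₂ z)) (inj₁ (inj₁ j)) = refl
  mutateZ-framedQ (inj₂ (inj₂ z)) (inj₁ (inj₂ y)) = refl
  mutateZ-framedQ (inj₂ (inj₂ z)) (inj₁ (inj₂ z)) = refl
  mutateZ-framedQ (inj₂ _) (inj₂ _) = refl

  -- Greenness is what prevents new arrows between the
  -- mutable copy z of x′ and the frozen vertices j′ (composites z → k → j′).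
  mutate-embed : (b : MatC) (k : Fin n) → Green b k
    → mutate ≟Ext (inj₁ k) (embed b) ≐ embed (mutate _≟_ k b)
  mutate-embed b k G (inj₁ (inj₁ i)) (inj₁ (inj₁ j)) = refl
  mutate-embed b k G (inj₁ (inj₁ i)) (inj₁ (inj₂ y)) =
    vanishing-branch-∸ (does (i ≟ k)) (b (inj₁ i) (inj₁ k) * 0) (*-zeroʳ (b (inj₁ i) (inj₁ k)))
  mutate-embed b k G (inj₁ (inj₁ i)) (inj₁ (inj₂ z)) = refl
  mutate-embed b k G (inj₁ (inj₁ i)) (inj₂ (inj₁ j)) = refl
  mutate-embed b k G (inj₁ (inj₁ i)) (inj₂ (inj₂ y)) =
    vanishing-branch-∸ (does (i ≟ k)) (b (inj₁ i) (inj₁ k) * 0) (*-zeroʳ (b (inj₁ i) (inj₁ k)))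
  mutate-embed b k G (inj₁ (inj₁ i)) (inj₂ (inj₂ z)) =
    vanishing-branch-∸ (does (i ≟ k)) (b (inj₁ i) (inj₁ k) * 0) (*-zeroʳ (b (inj₁ i) (inj₁ k)))
  mutate-embed b k G (inj₁ (inj₂ y)) (inj₁ (inj₁ j)) =
    zero-branches-∸ (does (j ≟ k)) (if does (j ≟ k) ∨ false then 0 else b (inj₁ j) (inj₁ k) * 0)
  mutate-embed b k G (inj₁ (inj₂ y)) (inj₁ (inj₂ y)) = refl
  mutate-embed b k G (inj₁ (inj₂ y)) (inj₁ (inj₂ z)) = refl
  mutate-embed b k G (inj₁ (inj₂ y)) (inj₂ (inj₁ j)) = 0∸n≡0 (b (inj₂ j) (inj₁ k) * 0)
  mutate-embed b k G (inj₁ (inj₂ y)) (inj₂ (inj₂ y)) = refl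
  mutate-embed b k G (inj₁ (inj₂ y)) (inj₂ (inj₂ z)) = refl
  mutate-embed b k G (inj₁ (inj₂ z)) (inj₁ (inj₁ j)) = refl
  mutate-embed b k G (inj₁ (inj₂ z)) (inj₁ (inj₂ y)) = cong suc (*-zeroʳ (b (inj₂ x) (inj₁ k)))
  mutate-embed b k G (inj₁ (inj₂ z)) (inj₁ (inj₂ z)) = n∸n≡0 (b (inj₂ x) (inj₁ k) * b (inj₁ k) (inj₂ x))
  mutate-embed b k G (inj₁ (inj₂ z)) (inj₂ (inj₁ j)) =
    cong₂ _∸_ (cong (_* b (inj₁ k) (inj₂ j)) (G x)) (cong (_* b (inj₁ k) (inj₂ x)) (G j))
  mutate-embed b k G (inj₁ (inj₂ z)) (inj₂ (inj₂ y)) = *-zeroʳ (b (inj₂ x) (inj₁ k))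
  mutate-embed b k G (inj₁ (inj₂ z)) (inj₂ (inj₂ z)) = cong (_∸ 1) (*-zeroʳ (b (inj₂ x) (inj₁ k)))
  mutate-embed b k G (inj₂ (inj₁ i)) (inj₁ (inj₁ j)) = refl
  mutate-embed b k G (inj₂ (inj₁ i)) (inj₁ (inj₂ y)) = *-zeroʳ (b (inj₂ i) (inj₁ k))
  mutate-embed b k G (inj₂ (inj₁ i)) (inj₁ (inj₂ z)) =
    cong₂ _∸_ (cong (_* b (inj₁ k) (inj₂ x)) (G i)) (cong (_* b (inj₁ k) (inj₂ i)) (G x))
  mutate-embed b k G (inj₂ (inj₂ y)) (inj₁ (inj₁ j)) =
    zero-branches-∸ (does (j ≟ k)) (if does (j ≟ k) ∨ false then 0 else b (inj₁ j) (inj₁ k) * 0)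
  mutate-embed b k G (inj₂ (inj₂ y)) (inj₁ (inj₂ y)) = refl
  mutate-embed b k G (inj₂ (inj₂ y)) (inj₁ (inj₂ z)) = 0∸n≡0 (b (inj₂ x) (inj₁ k) * 0)
  mutate-embed b k G (inj₂ (inj₂ z)) (inj₁ (inj₁ j)) =
    zero-branches-∸ (does (j ≟ k)) (if does (j ≟ k) ∨ false then 0 else b (inj₁ j) (inj₁ k) * 0)
  mutate-embed b k G (inj₂ (inj₂ z)) (inj₁ (inj₂ y)) = refl
  mutate-embed b k G (inj₂ (inj₂ z)) (inj₁ (inj₂ z)) = cong (1 ∸_) (*-zeroʳ (b (inj₂ x) (inj₁ k)))
  mutate-embed b k G (inj₂ _) (inj₂ _) = refl

  -- Greenness of a C-vertex transfers from b to anything ≐ `embed b`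
  -- (the new frozen vertices y′, z′ have no arrows into C).
  green-embed : (b : MatC) (B : MatQ) (k : Fin n) → B ≐ embed b
    → Green b k → Green B (inj₁ k)
  green-embed b B k e G (inj₁ j) = trans (e _ _) (G j)
  green-embed b B k e G (inj₂ y) = e _ _
  green-embed b B k e G (inj₂ z) = e _ _

  y-green : (b : MatC) → Green (embed b) (inj₂ y)
  y-green b (inj₁ j) = refl
  y-green b (inj₂ y) = refl
  y-green b (inj₂ z) = refl

  afterY : MatC → MatQ
  afterY b = mutate ≟Ext (inj₂ y) (embed b)

  -- μ_y reverses z′ → z into z → z′, so z is then green.
  z-green-afterY : (b : MatC) → Green (afterY b) (inj₂ z)
  z-green-afterY b (inj₁ j) = refl
  z-green-afterY b (inj₂ y) = refl
  z-green-afterY b (inj₂ z) = refl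

  afterY-shape : MatC → MatQ
  afterY-shape b (inj₂ _) (inj₂ _) = 0
  afterY-shape b (inj₁ (inj₁ i)) (inj₁ (inj₁ j)) = afterY b (inj₁ (inj₁ i)) (inj₁ (inj₁ j))
  afterY-shape b (inj₂ (inj₁ j)) (inj₁ (inj₁ i)) = b (inj₂ j) (inj₁ i)
  afterY-shape b (inj₁ (inj₂ z)) (inj₁ (inj₁ i)) = b (inj₂ x) (inj₁ i)
  afterY-shape b (inj₁ (inj₂ y)) (inj₁ (inj₂ z)) = 1
  afterY-shape b (inj₁ (inj₂ z)) (inj₂ (inj₂ y)) = 1
  afterY-shape b (inj₂ (inj₂ y)) (inj₁ (inj₂ y)) = 1
  afterY-shape b (inj₂ (inj₂ z)) (inj₁ (inj₂ y)) = 1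
  afterY-shape b _ _ = 0

  AllRed : MatC → Set
  AllRed b = (i : Fin n) → Red b i

  afterY-allRed : (b : MatC) → AllRed b → afterY b ≐ afterY-shape b
  afterY-allRed b R (inj₁ (inj₁ i)) (inj₁ (inj₁ j)) = refl
  afterY-allRed b R (inj₁ (inj₁ i)) (inj₁ (inj₂ y)) = refl
  afterY-allRed b R (inj₁ (inj₁ i)) (inj₁ (inj₂ z)) =
    red-source-∸ (b (inj₁ i) (inj₂ x)) (b (inj₂ x) (inj₁ i) + 0) (R i x)
  afterY-allRed b R (inj₁ (inj₁ i)) (inj₂ (inj₁ j)) =
    red-source-∸ (b (inj₁ i) (inj₂ j)) (b (inj₂ j) (inj₁ i) + 0) (R i j)
  afterY-allRed b R (inj₁ (inj₁ i)) (inj₂ (inj₂ y)) = refl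
  afterY-allRed b R (inj₁ (inj₁ i)) (inj₂ (inj₂ z)) = refl
  afterY-allRed b R (inj₁ (inj₂ y)) (inj₁ (inj₁ j)) = refl
  afterY-allRed b R (inj₁ (inj₂ y)) (inj₁ (inj₂ y)) = refl
  afterY-allRed b R (inj₁ (inj₂ y)) (inj₁ (inj₂ z)) = refl
  afterY-allRed b R (inj₁ (inj₂ y)) (inj₂ (inj₁ j)) = refl
  afterY-allRed b R (inj₁ (inj₂ y)) (inj₂ (inj₂ y)) = refl
  afterY-allRed b R (inj₁ (inj₂ y)) (inj₂ (inj₂ z)) = refl
  afterY-allRed b R (inj₁ (inj₂ z)) (inj₁ (inj₁ j)) =
    red-target-∸ (b (inj₂ x) (inj₁ j)) (b (inj₁ j) (inj₂ x)) (R j x)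
  afterY-allRed b R (inj₁ (inj₂ z)) (inj₁ (inj₂ y)) = refl
  afterY-allRed b R (inj₁ (inj₂ z)) (inj₁ (inj₂ z)) = refl
  afterY-allRed b R (inj₁ (inj₂ z)) (inj₂ (inj₁ j)) = refl
  afterY-allRed b R (inj₁ (inj₂ z)) (inj₂ (inj₂ y)) = refl
  afterY-allRed b R (inj₁ (inj₂ z)) (inj₂ (inj₂ z)) = refl
  afterY-allRed b R (inj₂ (inj₁ i)) (inj₁ (inj₁ j)) =
    red-target-∸ (b (inj₂ i) (inj₁ j)) (b (inj₁ j) (inj₂ i)) (R j i)
  afterY-allRed b R (inj₂ (inj₁ i)) (inj₁ (inj₂ y)) = refl
  afterY-allRed b R (inj₂ (inj₁ i)) (inj₁ (inj₂ z)) = refl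
  afterY-allRed b R (inj₂ (inj₂ y)) (inj₁ (inj₁ j)) = refl
  afterY-allRed b R (inj₂ (inj₂ y)) (inj₁ (inj₂ y)) = refl
  afterY-allRed b R (inj₂ (inj₂ y)) (inj₁ (inj₂ z)) = refl
  afterY-allRed b R (inj₂ (inj₂ z)) (inj₁ (inj₁ j)) = refl
  afterY-allRed b R (inj₂ (inj₂ z)) (inj₁ (inj₂ y)) = refl
  afterY-allRed b R (inj₂ (inj₂ z)) (inj₁ (inj₂ z)) = refl
  afterY-allRed b R (inj₂ _) (inj₂ _) = refl

  afterYZ-red : (b : MatC) (v : Vert) → Red (mutate ≟Ext (inj₂ z) (afterY-shape b)) v
  afterYZ-red b (inj₁ i) (inj₁ j) = 0∸n≡0 (b (inj₂ j) (inj₁ i) + 0)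
  afterYZ-red b (inj₁ i) (inj₂ y) = refl
  afterYZ-red b (inj₁ i) (inj₂ z) = refl
  afterYZ-red b (inj₂ y) (inj₁ j) = refl
  afterYZ-red b (inj₂ y) (inj₂ y) = refl
  afterYZ-red b (inj₂ y) (inj₂ z) = refl
  afterYZ-red b (inj₂ z) (inj₁ j) = refl
  afterYZ-red b (inj₂ z) (inj₂ y) = refl
  afterYZ-red b (inj₂ z) (inj₂ z) = refl

  yz : List Vert
  yz = inj₂ y ∷ inj₂ z ∷ []

  MaximalGreenFrom : MatQ → List Vert → Set
  MaximalGreenFrom B s = GreenSeq ≟Ext B s × ((v : Vert) → Red (mutateSeq ≟Ext s B) v)

  finish : (b : MatC) (B : MatQ) → B ≐ embed b → AllRed b → MaximalGreenFrom B yz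
  finish b B e R =
    ( (λ j → trans (e (inj₂ j) (inj₁ (inj₂ y))) (y-green b j))
    , (λ j → trans (mutate-cong ≟Ext (inj₂ y) e (inj₂ j) (inj₁ (inj₂ z))) (z-green-afterY b j))
    , tt )
    , λ v f → trans (mutate-cong ≟Ext (inj₂ z) afterY-≐ (inj₁ v) (inj₂ f)) (afterYZ-red b v f)
    where
    afterY-≐ : mutate ≟Ext (inj₂ y) B ≐ afterY-shape b
    afterY-≐ = ≐-trans (mutate-cong ≟Ext (inj₂ y) e) (afterY-allRed b R)

  run : (iC : List (Fin n)) (b : MatC) (B : MatQ) → B ≐ embed b
    → GreenSeq _≟_ b iC → AllRed (mutateSeq _≟_ iC b)
    → MaximalGreenFrom B (map inj₁ iC ++ yz)
  run []       b B e _        R = finish b B e R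
  run (k ∷ ks) b B e (G , gs) R = (green-embed b B k e G , proj₁ rest) , proj₂ rest
    where
    rest : MaximalGreenFrom (mutate ≟Ext (inj₁ k) B) (map inj₁ ks ++ yz)
    rest = run ks (mutate _≟_ k b) (mutate ≟Ext (inj₁ k) B)
             (≐-trans (mutate-cong ≟Ext (inj₁ k) e) (mutate-embed b k G)) gs R

lemma5p2 : (n : ℕ) (C : Quiver (Fin n)) (x : Fin n) (iC : List (Fin n))
    → MaximalGreenSequence _≟_ C iC
    → MaximalGreenSequence ≟Ext (extQuiver C x)
        (inj₂ z ∷ (map inj₁ iC ++ (inj₂ y ∷ inj₂ z ∷ [])))
lemma5p2 n C x iC (greenC , redC) = (z-green , proj₁ tail) , proj₂ tail
  where
  open Construction C x
  z-green : Green framedQ (inj₂ z)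
  z-green j = refl
  tail : MaximalGreenFrom (mutate ≟Ext (inj₂ z) framedQ) (map inj₁ iC ++ yz)
  tail = run iC framedC (mutate ≟Ext (inj₂ z) framedQ) mutateZ-framedQ greenC redC
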